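{- Every effectively bi-immune set $X\subseteq\mathbb{N}$ computes a computably bounded DNC function.
   Context: $W_e$ is the $e$-th c.e. set and $\Phi_e$ the $e$-th partial computable function. A set $A$ is effectively immune if it is infinite and there is a computable $h$ such that $W_e\subseteq A$ implies $|W_e|\le h(e)$ for all $e$. $X$ is effectively bi-immune if both $X$ and its complement are effectively immune. A function $f$ is DNC if $f(e)\ne\Phi_e(e)$ for all $e$, and computably bounded if $f(e)\le h(e)$ for all $e$ for some computable $h$. -}

module Defs where

open import Data.Nat using (ℕ; zero; suc; _+_; _*_; _∸_; _^_; _≤_)
open import Data.Bool using (Bool; true; false)
open import Data.Product using (Σ; _×_; _,_; ∃)
open import Data.List using (List; length)
open import Data.List.Relation.Unary.All using (All)
open import Data.List.Relation.Unary.Unique.Propositional using (Unique)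
open import Relation.Binary.PropositionalEquality using (_≡_)
open import Relation.Nullary using (¬_)

⟨_,_⟩ : ℕ → ℕ → ℕ
⟨ a , b ⟩ = (2 ^ a) * (2 * b + 1) ∸ 1

data Code : Set where
  zer    : Code
  succ   : Code
  ident  : Code
  orc    : Code
  fst    : Code
  snd    : Code
  comp   : Code → Code → Code
  pairC  : Code → Code → Code
  rec    : Code → Code → Code
  mu     : Code → Code

Oracle : Set
Oracle = ℕ → ℕ

data Eval (O : Oracle) : Code → ℕ → ℕ → Set where
  ev-zer   : ∀ {x} → Eval O zer x 0
  ev-succ  : ∀ {x} → Eval O succ x (suc x)
  ev-ident : ∀ {x} → Eval O ident x x
  ev-orc   : ∀ {x} → Eval O orc x (O x)
  ev-fst   : ∀ {a b} → Eval O fst ⟨ a , b ⟩ a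
  ev-snd   : ∀ {a b} → Eval O snd ⟨ a , b ⟩ b
  ev-comp  : ∀ {f g x y z} → Eval O g x y → Eval O f y z → Eval O (comp f g) x z
  ev-pair  : ∀ {f g x y z} → Eval O f x y → Eval O g x z → Eval O (pairC f g) x ⟨ y , z ⟩
  ev-rec0  : ∀ {f g x y} → Eval O f x y → Eval O (rec f g) ⟨ x , 0 ⟩ y
  ev-recS  : ∀ {f g x n y z} → Eval O (rec f g) ⟨ x , n ⟩ y →
             Eval O g ⟨ x , ⟨ n , y ⟩ ⟩ z → Eval O (rec f g) ⟨ x , suc n ⟩ z
  ev-mu    : ∀ {f x n} → Eval O f ⟨ x , n ⟩ 0 →
             (∀ m → suc m ≤ n → Σ ℕ λ k → Eval O f ⟨ x , m ⟩ (suc k)) →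
             Eval O (mu f) x n

encode : Code → ℕ
encode zer         = ⟨ 0 , 0 ⟩
encode succ        = ⟨ 1 , 0 ⟩
encode ident       = ⟨ 2 , 0 ⟩
encode orc         = ⟨ 3 , 0 ⟩
encode fst         = ⟨ 4 , 0 ⟩
encode snd         = ⟨ 5 , 0 ⟩
encode (comp f g)  = ⟨ 6 , ⟨ encode f , encode g ⟩ ⟩
encode (pairC f g) = ⟨ 7 , ⟨ encode f , encode g ⟩ ⟩
encode (rec f g)   = ⟨ 8 , ⟨ encode f , encode g ⟩ ⟩
encode (mu f)      = ⟨ 9 , encode f ⟩

-- Φ^O_e(x) ↓= y.  Indices that do not code a program give the empty function.
Φ^ : Oracle → ℕ → ℕ → ℕ → Set
Φ^ O e x y = Σ Code λ c → (encode c ≡ e) × Eval O c x y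

-- The empty oracle: unrelativised computation.
∅ : Oracle
∅ _ = 0

Φ : ℕ → ℕ → ℕ → Set
Φ = Φ^ ∅

_∈W_ : ℕ → ℕ → Set
x ∈W e = ∃ λ y → Φ e x y

Computable : (ℕ → ℕ) → Set
Computable h = Σ Code λ c → ∀ n → Eval ∅ c n (h n)

χ : (ℕ → Bool) → Oracle
χ X n with X n
... | true  = 1
... | false = 0

Computes : (ℕ → Bool) → (ℕ → ℕ) → Set
Computes X f = Σ Code λ c → ∀ n → Eval (χ X) c n (f n)

Infinite : (ℕ → Set) → Set
Infinite A = ∀ n → Σ ℕ λ m → n ≤ m × A m

W⊆ : ℕ → (ℕ → Set) → Set
W⊆ e A = ∀ x → x ∈W e → A x

CardW≤ : ℕ → ℕ → Set
CardW≤ e k = (l : List ℕ) → Unique l → All (λ x → x ∈W e) l → length l ≤ k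

EffectivelyImmune : (ℕ → Set) → Set
EffectivelyImmune A =
  Infinite A × (Σ (ℕ → ℕ) λ h → Computable h × (∀ e → W⊆ e A → CardW≤ e (h e)))

_∈S_ : ℕ → (ℕ → Bool) → Set
n ∈S X = X n ≡ true

_∉S_ : ℕ → (ℕ → Bool) → Set
n ∉S X = X n ≡ false

EffectivelyBiImmune : (ℕ → Bool) → Set
EffectivelyBiImmune X =
  EffectivelyImmune (λ n → n ∈S X) × EffectivelyImmune (λ n → n ∉S X)

DNC : (ℕ → ℕ) → Set
DNC f = ∀ e → ¬ Φ e e (f e)

ComputablyBounded : (ℕ → ℕ) → Set
ComputablyBounded f = Σ (ℕ → ℕ) λ h → Computable h × (∀ e → f e ≤ h e)

module Submission where

-- Let h₁, h₀ witness effective immunity of X and of its complement.  Uniformly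
-- in e there are c.e. indices d₁(e), d₀(e) such that W_{dᵢ(e)} is the set of
-- positions x at which the first (i = 1) or second (i = 0) component of
-- Φ_e(e), read as a finite sequence coded by nested pairs, is nonzero.  With
-- N = 1 + h₁(d₁ e) + h₀(d₀ e), let f(e) pair the codes of the characteristic
-- sequences of X and of its complement on [0, N).  Then f ≤_T X, and f is
-- bounded by the computable code of two all-ones sequences.  If Φ_e(e) = f(e),
-- the two sets are X ∩ [0,N) and X̄ ∩ [0,N), so immunity yields
-- N ≤ h₁(d₁ e) + h₀(d₀ e) < N.  The file establishes in turn: pairing is a
-- bijection; evaluation is deterministic and the numbering injective; a small
-- library of programs; s-m-n for templates; reading sequence codes; counting;
-- the diagonal sets; the construction and the theorem.

open import Defs
open import Data.Nat
open import Data.Nat.Properties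
open import Data.Nat.Induction using (<-rec)
open import Data.Product
open import Data.Sum using (_⊎_; inj₁; inj₂)
open import Data.Empty using (⊥-elim)
open import Data.Bool using (Bool; true; false; if_then_else_; not)
open import Data.Bool.Properties using (not-injective)
open import Data.List using (List; []; _∷_; length)
open import Data.List.Relation.Unary.All as All using (All; []; _∷_)
open import Data.List.Relation.Unary.Unique.Propositional using (Unique)
open import Data.List.Relation.Unary.AllPairs using ([]; _∷_)
open import Function using (_∘_)
open import Relation.Binary using (tri<; tri≈; tri>)
open import Relation.Binary.PropositionalEquality
open import Relation.Nullary using (yes; no)

-- The pairing function is a bijection ℕ × ℕ → ℕ

-- The number 2^a · (2b + 1), whose predecessor is ⟨ a , b ⟩.
pos : ℕ → ℕ → ℕ
pos a b = 2 ^ a * suc (2 * b)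

pos-zero : ∀ b → pos 0 b ≡ suc (2 * b)
pos-zero b = *-identityˡ _

pos-suc : ∀ a b → pos (suc a) b ≡ 2 * pos a b
pos-suc a b = *-assoc 2 (2 ^ a) _

-- The successor of ⟨ a , b ⟩ is pos a b (pos is positive, so ∸ 1 is undone).
suc-⟨⟩ : ∀ a b → suc ⟨ a , b ⟩ ≡ pos a b
suc-⟨⟩ a b = begin
  suc ⟨ a , b ⟩      ≡⟨ cong (λ t → suc (2 ^ a * t ∸ 1)) (+-comm (2 * b) 1) ⟩
  suc (pos a b ∸ 1)  ≡⟨ +-comm 1 _ ⟩
  pos a b ∸ 1 + 1    ≡⟨ m∸n+n≡m (*-mono-≤ (m^n>0 2 a) (s≤s z≤n)) ⟩
  pos a b            ∎
  where open ≡-Reasoning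

-- Uniqueness of the factorisation 2^a · odd, via parity and cancellation of 2.
pos-injective : ∀ {a b a' b'} → pos a b ≡ pos a' b' → a ≡ a' × b ≡ b'
pos-injective {zero} {b} {zero} {b'} eq =
  refl , *-cancelˡ-≡ b b' 2 (suc-injective (trans (sym (pos-zero b)) (trans eq (pos-zero b'))))
pos-injective {zero} {b} {suc a'} {b'} eq =
  ⊥-elim (even≢odd (pos a' b') b (sym (trans (sym (pos-zero b)) (trans eq (pos-suc a' b')))))
pos-injective {suc a} {b} {zero} {b'} eq =
  ⊥-elim (even≢odd (pos a b) b' (trans (sym (pos-suc a b)) (trans eq (pos-zero b'))))
pos-injective {suc a} {b} {suc a'} {b'} eq =
  map₁ (cong suc) (pos-injective (*-cancelˡ-≡ _ _ 2 (trans (sym (pos-suc a b)) (trans eq (pos-suc a' b')))))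

pair-injective : ∀ {a b a' b'} → ⟨ a , b ⟩ ≡ ⟨ a' , b' ⟩ → a ≡ a' × b ≡ b'
pair-injective {a} {b} {a'} {b'} eq = pos-injective (trans (sym (suc-⟨⟩ a b)) (trans (cong suc eq) (suc-⟨⟩ a' b')))

evenOrOdd : ∀ n → (∃ λ m → n ≡ 2 * m) ⊎ (∃ λ m → n ≡ suc (2 * m))
evenOrOdd zero = inj₁ (0 , refl)
evenOrOdd (suc n) with evenOrOdd n
... | inj₁ (m , n≡2m)   = inj₂ (m , cong suc n≡2m)
... | inj₂ (m , n≡2m+1) = inj₁ (suc m , trans (cong suc n≡2m+1) (cong suc (sym (+-suc m (m + 0)))))

-- Every positive number is 2^a · (2b + 1), by strong induction halving even numbers.
factor : ∀ n → ∃₂ λ a b → pos a b ≡ suc n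
factor = <-rec _ go
  where
    go : ∀ n → (∀ {m} → m < n → ∃₂ λ a b → pos a b ≡ suc m) → ∃₂ λ a b → pos a b ≡ suc n
    go n ih with evenOrOdd (suc n)
    ... | inj₂ (m , odd)        = 0 , m , trans (pos-zero m) (sym odd)
    ... | inj₁ (zero , ())
    ... | inj₁ (suc m , even) with ih (subst (m <_) (sym (suc-injective even)) (m<m+n m z<s))
    ...   | a , b , q = suc a , b , trans (pos-suc a b) (trans (cong (2 *_) q) (sym even))

unpair : ∀ n → ∃₂ λ a b → ⟨ a , b ⟩ ≡ n
unpair n with factor n
... | a , b , q = a , b , suc-injective (trans (suc-⟨⟩ a b) q)

π₁ π₂ : ℕ → ℕ
π₁ n = proj₁ (unpair n)
π₂ n = proj₁ (proj₂ (unpair n))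

π-η : ∀ n → ⟨ π₁ n , π₂ n ⟩ ≡ n
π-η n = proj₂ (proj₂ (unpair n))

π₁-β : ∀ a b → π₁ ⟨ a , b ⟩ ≡ a
π₁-β a b = proj₁ (pair-injective {π₁ ⟨ a , b ⟩} {π₂ ⟨ a , b ⟩} {a} {b} (π-η ⟨ a , b ⟩))

π₂-β : ∀ a b → π₂ ⟨ a , b ⟩ ≡ b
π₂-β a b = proj₂ (pair-injective {π₁ ⟨ a , b ⟩} {π₂ ⟨ a , b ⟩} {a} {b} (π-η ⟨ a , b ⟩))

pair-mono : ∀ {a a' b b'} → a ≤ a' → b ≤ b' → ⟨ a , b ⟩ ≤ ⟨ a' , b' ⟩
pair-mono a≤a' b≤b' = ∸-monoˡ-≤ 1 (*-mono-≤ (^-monoʳ-≤ 2 a≤a') (+-monoˡ-≤ 1 (*-monoʳ-≤ 2 b≤b')))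

-- Evaluation is deterministic and the Gödel numbering is injective;
-- together they make each Φ^O_e a partial function of its input.

-- The output is determined by program and input; the inputs may be given up to
-- equality because ⟨_,_⟩ is not a constructor.
eval-deterministic : ∀ {O c x y x' y'} → Eval O c x y → Eval O c x' y' → x ≡ x' → y ≡ y'
eval-deterministic ev-zer ev-zer _ = refl
eval-deterministic ev-succ ev-succ x≡ = cong suc x≡
eval-deterministic ev-ident ev-ident x≡ = x≡
eval-deterministic {O} ev-orc ev-orc x≡ = cong O x≡
eval-deterministic (ev-fst {a} {b}) (ev-fst {a'} {b'}) x≡ = proj₁ (pair-injective {a} {b} {a'} {b'} x≡)
eval-deterministic (ev-snd {a} {b}) (ev-snd {a'} {b'}) x≡ = proj₂ (pair-injective {a} {b} {a'} {b'} x≡)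
eval-deterministic (ev-comp g f) (ev-comp g' f') x≡ =
  eval-deterministic f f' (eval-deterministic g g' x≡)
eval-deterministic (ev-pair f g) (ev-pair f' g') x≡ =
  cong₂ ⟨_,_⟩ (eval-deterministic f f' x≡) (eval-deterministic g g' x≡)
eval-deterministic (ev-rec0 {x = x} f) (ev-rec0 {x = x'} f') x≡ =
  eval-deterministic f f' (proj₁ (pair-injective {x} {0} {x'} {0} x≡))
eval-deterministic (ev-rec0 {x = x} _) (ev-recS {x = x'} {n = n'} _ _) x≡
  with () ← proj₂ (pair-injective {x} {0} {x'} {suc n'} x≡)
eval-deterministic (ev-recS {x = x} {n = n} _ _) (ev-rec0 {x = x'} _) x≡
  with () ← proj₂ (pair-injective {x} {suc n} {x'} {0} x≡)
eval-deterministic (ev-recS {x = x} {n = n} r g) (ev-recS {x = x'} {n = n'} r' g') x≡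
  with pair-injective {x} {suc n} {x'} {suc n'} x≡
... | refl , refl = eval-deterministic g g' (cong (λ y → ⟨ x , ⟨ n , y ⟩ ⟩) (eval-deterministic r r' refl))
eval-deterministic (ev-mu {n = n} f earlier) (ev-mu {n = n'} f' earlier') x≡ with <-cmp n n'
... | tri≈ _ n≡n' _ = n≡n'
... | tri< n<n' _ _ with () ← eval-deterministic f (proj₂ (earlier' n n<n')) (cong ⟨_, n ⟩ x≡)
... | tri> _ _ n'<n with () ← eval-deterministic (proj₂ (earlier n' n'<n)) f' (cong ⟨_, n' ⟩ x≡)

label : Code → ℕ
label zer         = 0
label succ        = 1
label ident       = 2
label orc         = 3
label fst         = 4
label snd         = 5
label (comp _ _)  = 6
label (pairC _ _) = 7
label (rec _ _)   = 8
label (mu _)      = 9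

args : Code → ℕ
args (comp f g)  = ⟨ encode f , encode g ⟩
args (pairC f g) = ⟨ encode f , encode g ⟩
args (rec f g)   = ⟨ encode f , encode g ⟩
args (mu f)      = encode f
args _           = 0

encode-split : ∀ c → encode c ≡ ⟨ label c , args c ⟩
encode-split zer         = refl
encode-split succ        = refl
encode-split ident       = refl
encode-split orc         = refl
encode-split fst         = refl
encode-split snd         = refl
encode-split (comp _ _)  = refl
encode-split (pairC _ _) = refl
encode-split (rec _ _)   = refl
encode-split (mu _)      = refl

-- Root t c : the outermost constructor of c has label t.  Matching two such
-- views with the same label leaves only the diagonal cases.
data Root : ℕ → Code → Set where
  r-zer   : Root 0 zer
  r-succ  : Root 1 succ
  r-ident : Root 2 ident
  r-orc   : Root 3 orc
  r-fst   : Root 4 fst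
  r-snd   : Root 5 snd
  r-comp  : ∀ {f g} → Root 6 (comp f g)
  r-pair  : ∀ {f g} → Root 7 (pairC f g)
  r-rec   : ∀ {f g} → Root 8 (rec f g)
  r-mu    : ∀ {f} → Root 9 (mu f)

root : ∀ c → Root (label c) c
root zer         = r-zer
root succ        = r-succ
root ident       = r-ident
root orc         = r-orc
root fst         = r-fst
root snd         = r-snd
root (comp _ _)  = r-comp
root (pairC _ _) = r-pair
root (rec _ _)   = r-rec
root (mu _)      = r-mu

encode-injective : ∀ {c c'} → encode c ≡ encode c' → c ≡ c'
encode-injective₂ : ∀ {f g f' g'} → ⟨ encode f , encode g ⟩ ≡ ⟨ encode f' , encode g' ⟩ → f ≡ f' × g ≡ g'
sameRoot : ∀ {t c c'} → Root t c → Root t c' → args c ≡ args c' → c ≡ c'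

encode-injective {c} {c'} eq with pair-injective (trans (sym (encode-split c)) (trans eq (encode-split c')))
... | labels , argsEq = sameRoot (root c) (subst (λ t → Root t c') (sym labels) (root c')) argsEq

encode-injective₂ {f} {g} {f'} {g'} eq with pair-injective {encode f} {encode g} {encode f'} {encode g'} eq
... | f≡f' , g≡g' = encode-injective f≡f' , encode-injective g≡g'

sameRoot r-zer   r-zer   _  = refl
sameRoot r-succ  r-succ  _  = refl
sameRoot r-ident r-ident _  = refl
sameRoot r-orc   r-orc   _  = refl
sameRoot r-fst   r-fst   _  = refl
sameRoot r-snd   r-snd   _  = refl
sameRoot r-comp  r-comp  eq = uncurry (cong₂ comp) (encode-injective₂ eq)
sameRoot r-pair  r-pair  eq = uncurry (cong₂ pairC) (encode-injective₂ eq)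
sameRoot r-rec   r-rec   eq = uncurry (cong₂ rec) (encode-injective₂ eq)
sameRoot r-mu    r-mu    eq = cong mu (encode-injective eq)

-- A library of programs.  Except for orc, none of them consults the
-- oracle, so each evaluation lemma holds relative to every oracle O.

const : ℕ → Code
const zero    = zer
const (suc n) = comp succ (const n)

const-ev : ∀ {O} n {x} → Eval O (const n) x n
const-ev zero    = ev-zer
const-ev (suc n) = ev-comp (const-ev n) ev-succ

-- ev-pair with its two outputs named (they cannot be inferred from ⟨ a , b ⟩).
pair-ev : ∀ {O f g x} a b → Eval O f x a → Eval O g x b → Eval O (pairC f g) x ⟨ a , b ⟩
pair-ev a b = ev-pair {y = a} {z = b}

-- fst and snd are the projections on every input, not just on literal pairs.
π₁-ev : ∀ {O} n → Eval O fst n (π₁ n)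
π₁-ev {O} n = subst (λ m → Eval O fst m (π₁ n)) (π-η n) (ev-fst {a = π₁ n} {b = π₂ n})

π₂-ev : ∀ {O} n → Eval O snd n (π₂ n)
π₂-ev {O} n = subst (λ m → Eval O snd m (π₂ n)) (π-η n) (ev-snd {a = π₁ n} {b = π₂ n})

counter previous : Code
counter  = comp fst snd
previous = comp snd snd

counter-ev : ∀ {O} x n y → Eval O counter ⟨ x , ⟨ n , y ⟩ ⟩ n
counter-ev x n y = ev-comp (ev-snd {a = x}) (ev-fst {a = n} {b = y})

previous-ev : ∀ {O} x n y → Eval O previous ⟨ x , ⟨ n , y ⟩ ⟩ y
previous-ev x n y = ev-comp (ev-snd {a = x}) (ev-snd {a = n} {b = y})

iterate : Code → Code → Code
iterate f g = comp (rec f g) (pairC zer ident)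

iterate-ev : ∀ {O f g x y} → Eval O (rec f g) ⟨ 0 , x ⟩ y → Eval O (iterate f g) x y
iterate-ev {x = x} = ev-comp (pair-ev 0 x ev-zer ev-ident)

-- The zero test; it turns a nonzero entry into a halting search.
isZero : ℕ → ℕ
isZero zero    = 1
isZero (suc _) = 0

isZero≡0⇒≢0 : ∀ {n} → isZero n ≡ 0 → n ≢ 0
isZero≡0⇒≢0 {zero}  ()
isZero≡0⇒≢0 {suc n} _ ()

≢0⇒isZero≡0 : ∀ {n} → n ≢ 0 → isZero n ≡ 0
≢0⇒isZero≡0 {zero}  n≢0 = ⊥-elim (n≢0 refl)
≢0⇒isZero≡0 {suc n} _   = refl

isZeroP : Code
isZeroP = iterate (const 1) zer

isZero-ev : ∀ {O} n → Eval O isZeroP n (isZero n)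
isZero-ev n = iterate-ev (go n)
  where
    go : ∀ {O} n → Eval O (rec (const 1) zer) ⟨ 0 , n ⟩ (isZero n)
    go zero    = ev-rec0 {x = 0} (const-ev 1)
    go (suc n) = ev-recS {x = 0} (go n) ev-zer

predP : Code
predP = iterate zer counter

pred-ev : ∀ {O} n → Eval O predP n (pred n)
pred-ev n = iterate-ev (go n)
  where
    go : ∀ {O} n → Eval O (rec zer counter) ⟨ 0 , n ⟩ (pred n)
    go zero    = ev-rec0 {x = 0} ev-zer
    go (suc n) = ev-recS {x = 0} {n = n} {y = pred n} (go n) (counter-ev 0 n (pred n))

monusP : Code
monusP = rec ident (comp predP previous)

monus-ev : ∀ {O} a k → Eval O monusP ⟨ a , k ⟩ (a ∸ k)
monus-ev a zero    = ev-rec0 ev-ident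
monus-ev {O} a (suc k) = subst (Eval O monusP ⟨ a , suc k ⟩) (pred[m∸n]≡m∸[1+n] a k)
  (ev-recS {x = a} {n = k} {y = a ∸ k} (monus-ev a k) (ev-comp (previous-ev a k (a ∸ k)) (pred-ev (a ∸ k))))

plusP : Code
plusP = rec ident (comp succ previous)

plus-ev : ∀ {O} a k → Eval O plusP ⟨ a , k ⟩ (a + k)
plus-ev {O} a zero    = subst (Eval O plusP ⟨ a , 0 ⟩) (sym (+-identityʳ a)) (ev-rec0 ev-ident)
plus-ev {O} a (suc k) = subst (Eval O plusP ⟨ a , suc k ⟩) (sym (+-suc a k))
  (ev-recS {x = a} {n = k} {y = a + k} (plus-ev a k) (ev-comp (previous-ev a k (a + k)) ev-succ))

drop : ℕ → ℕ → ℕ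
drop v zero    = v
drop v (suc n) = π₂ (drop v n)

dropP : Code
dropP = rec ident (comp snd previous)

drop-ev : ∀ {O} v n → Eval O dropP ⟨ v , n ⟩ (drop v n)
drop-ev v zero    = ev-rec0 ev-ident
drop-ev v (suc n) = ev-recS {x = v} {n = n} {y = drop v n} (drop-ev v n) (ev-comp (previous-ev v n (drop v n)) (π₂-ev (drop v n)))

-- suffix p N k codes the last k of the entries p 0, …, p (N ∸ 1):
-- ⟨ p (N ∸ k) , ⟨ … ⟨ p (N ∸ 1) , 0 ⟩ … ⟩ ⟩.
suffix : (ℕ → ℕ) → ℕ → ℕ → ℕ
suffix p N zero    = 0
suffix p N (suc k) = ⟨ p (N ∸ suc k) , suffix p N k ⟩

seqCode : (ℕ → ℕ) → ℕ → ℕ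
seqCode p N = suffix p N N

-- The step of the recursion building suffix p N (k + 1) from suffix p N k
-- first computes the position N ∸ (k + 1) from ⟨ N , ⟨ k , _ ⟩ ⟩.
positionP : Code
positionP = comp monusP (pairC fst (comp succ counter))

position-ev : ∀ {O} N k y → Eval O positionP ⟨ N , ⟨ k , y ⟩ ⟩ (N ∸ suc k)
position-ev N k y = ev-comp (pair-ev N (suc k) (ev-fst {a = N} {b = ⟨ k , y ⟩}) (ev-comp (counter-ev N k y) ev-succ))
                            (monus-ev N (suc k))

seqP : Code → Code
seqP q = comp (rec zer (pairC (comp q positionP) previous)) (pairC ident ident)

seq-ev : ∀ {O q p} → (∀ i → Eval O q i (p i)) → ∀ N → Eval O (seqP q) N (seqCode p N)
seq-ev {O} {q} {p} q-ev N = ev-comp (pair-ev N N ev-ident ev-ident) (suffix-ev N)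
  where
    suffix-ev : ∀ k → Eval O (rec zer (pairC (comp q positionP) previous)) ⟨ N , k ⟩ (suffix p N k)
    suffix-ev zero    = ev-rec0 {x = N} ev-zer
    suffix-ev (suc k) = ev-recS {x = N} {n = k} {y = suffix p N k} (suffix-ev k)
      (pair-ev (p (N ∸ suc k)) (suffix p N k)
               (ev-comp (position-ev N k (suffix p N k)) (q-ev (N ∸ suc k)))
               (previous-ev N k (suffix p N k)))

strip : Code → Code
strip orc         = zer
strip (comp f g)  = comp (strip f) (strip g)
strip (pairC f g) = pairC (strip f) (strip g)
strip (rec f g)   = rec (strip f) (strip g)
strip (mu f)      = mu (strip f)
strip c           = c

strip-ev : ∀ {O c x y} → Eval ∅ c x y → Eval O (strip c) x y
strip-ev ev-zer          = ev-zer
strip-ev ev-succ         = ev-succ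
strip-ev ev-ident        = ev-ident
strip-ev ev-orc          = ev-zer
strip-ev (ev-fst {a} {b}) = ev-fst {a = a} {b = b}
strip-ev (ev-snd {a} {b}) = ev-snd {a = a} {b = b}
strip-ev (ev-comp g f)   = ev-comp (strip-ev g) (strip-ev f)
strip-ev (ev-pair f g)   = ev-pair (strip-ev f) (strip-ev g)
strip-ev (ev-rec0 f)     = ev-rec0 (strip-ev f)
strip-ev (ev-recS {x = x} {n = n} {y = y} r g) = ev-recS {x = x} {n = n} {y = y} (strip-ev r) (strip-ev g)
strip-ev (ev-mu f earlier) = ev-mu (strip-ev f) (λ m m<n → map₂ strip-ev (earlier m m<n))

-- Programs that output codes of programs: an s-m-n theorem for templates

-- codeOf c is a constant program printing the code of c; it follows the
-- structure of c, so the (huge) number encode c is never computed.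
codeOf argsCodeOf : Code → Code
codeOf c = pairC (const (label c)) (argsCodeOf c)

argsCodeOf (comp f g)  = pairC (codeOf f) (codeOf g)
argsCodeOf (pairC f g) = pairC (codeOf f) (codeOf g)
argsCodeOf (rec f g)   = pairC (codeOf f) (codeOf g)
argsCodeOf (mu f)      = codeOf f
argsCodeOf _           = zer

codeOf-ev : ∀ {O} c {x} → Eval O (codeOf c) x (encode c)
argsCodeOf-ev : ∀ {O} c {x} → Eval O (argsCodeOf c) x (args c)

codeOf-ev {O} c {x} = subst (Eval O (codeOf c) x) (sym (encode-split c))
  (pair-ev (label c) (args c) (const-ev (label c)) (argsCodeOf-ev c))

argsCodeOf-ev (comp f g)  = pair-ev (encode f) (encode g) (codeOf-ev f) (codeOf-ev g)
argsCodeOf-ev (pairC f g) = pair-ev (encode f) (encode g) (codeOf-ev f) (codeOf-ev g)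
argsCodeOf-ev (rec f g)   = pair-ev (encode f) (encode g) (codeOf-ev f) (codeOf-ev g)
argsCodeOf-ev (mu f)      = codeOf-ev f
argsCodeOf-ev zer         = ev-zer
argsCodeOf-ev succ        = ev-zer
argsCodeOf-ev ident       = ev-zer
argsCodeOf-ev orc         = ev-zer
argsCodeOf-ev fst         = ev-zer
argsCodeOf-ev snd         = ev-zer

constCodeP : Code
constCodeP = iterate (codeOf zer) (pairC (const 6) (pairC (codeOf succ) previous))

constCode-ev : ∀ {O} e → Eval O constCodeP e (encode (const e))
constCode-ev e = iterate-ev (go e)
  where
    go : ∀ {O} e → Eval O (rec (codeOf zer) (pairC (const 6) (pairC (codeOf succ) previous)))
                           ⟨ 0 , e ⟩ (encode (const e))
    go zero    = ev-rec0 {x = 0} (codeOf-ev zer)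
    go (suc e) = ev-recS {x = 0} {n = e} {y = encode (const e)} (go e)
      (pair-ev 6 _ (const-ev 6)
        (pair-ev (encode succ) (encode (const e)) (codeOf-ev succ) (previous-ev 0 e (encode (const e)))))

-- A program with two kinds of holes: one for a program c, and one for the
-- constant program outputting the code of c.
data Template : Set where
  lit         : Code → Template
  self        : Template
  selfCode    : Template
  compT pairT : Template → Template → Template
  muT         : Template → Template

fill : Template → Code → Code
fill (lit d)     c = d
fill self        c = c
fill selfCode    c = const (encode c)
fill (compT t u) c = comp (fill t c) (fill u c)
fill (pairT t u) c = pairC (fill t c) (fill u c)
fill (muT t)     c = mu (fill t c)

-- index t e is the code of fill t c, computed from e = encode c alone.
index : Template → ℕ → ℕ
index (lit d)     e = encode d
index self        e = e
index selfCode    e = encode (const e)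
index (compT t u) e = ⟨ 6 , ⟨ index t e , index u e ⟩ ⟩
index (pairT t u) e = ⟨ 7 , ⟨ index t e , index u e ⟩ ⟩
index (muT t)     e = ⟨ 9 , index t e ⟩

index-fill : ∀ t c → index t (encode c) ≡ encode (fill t c)
index-fill (lit d)     c = refl
index-fill self        c = refl
index-fill selfCode    c = refl
index-fill (compT t u) c = cong₂ (λ a b → ⟨ 6 , ⟨ a , b ⟩ ⟩) (index-fill t c) (index-fill u c)
index-fill (pairT t u) c = cong₂ (λ a b → ⟨ 7 , ⟨ a , b ⟩ ⟩) (index-fill t c) (index-fill u c)
index-fill (muT t)     c = cong ⟨ 9 ,_⟩ (index-fill t c)

indexP : Template → Code
indexP (lit d)     = codeOf d
indexP self        = ident
indexP selfCode    = constCodeP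
indexP (compT t u) = pairC (const 6) (pairC (indexP t) (indexP u))
indexP (pairT t u) = pairC (const 7) (pairC (indexP t) (indexP u))
indexP (muT t)     = pairC (const 9) (indexP t)

index-ev : ∀ {O} t e → Eval O (indexP t) e (index t e)
index-ev (lit d)     e = codeOf-ev d
index-ev self        e = ev-ident
index-ev selfCode    e = constCode-ev e
index-ev (compT t u) e =
  pair-ev 6 _ (const-ev 6) (pair-ev (index t e) (index u e) (index-ev t e) (index-ev u e))
index-ev (pairT t u) e =
  pair-ev 7 _ (const-ev 7) (pair-ev (index t e) (index u e) (index-ev t e) (index-ev u e))
index-ev (muT t)     e = pair-ev 9 (index t e) (const-ev 9) (index-ev t e)

-- Reading finite sequences coded by nested pairs

entry : ℕ → ℕ → ℕ
entry v x = π₁ (drop v x)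

drop-zero : ∀ n → drop 0 n ≡ 0
drop-zero zero    = refl
drop-zero (suc n) = trans (cong π₂ (drop-zero n)) (π₂-β 0 0)

drop-tail : ∀ a v n → drop ⟨ a , v ⟩ (suc n) ≡ drop v n
drop-tail a v zero    = π₂-β a v
drop-tail a v (suc n) = cong π₂ (drop-tail a v n)

entry-suffix : ∀ p N k x → x < k → entry (suffix p N k) x ≡ p (N ∸ (k ∸ x))
entry-suffix p N (suc k) zero    _   = π₁-β (p (N ∸ suc k)) (suffix p N k)
entry-suffix p N (suc k) (suc x) x<k =
  trans (cong π₁ (drop-tail (p (N ∸ suc k)) (suffix p N k) x)) (entry-suffix p N k x (s≤s⁻¹ x<k))

drop-suffix : ∀ p N k x → k ≤ x → drop (suffix p N k) x ≡ 0
drop-suffix p N zero    x       _   = drop-zero x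
drop-suffix p N (suc k) (suc x) k≤x =
  trans (drop-tail (p (N ∸ suc k)) (suffix p N k) x) (drop-suffix p N k x (s≤s⁻¹ k≤x))

entry-seq-in : ∀ p N x → x < N → entry (seqCode p N) x ≡ p x
entry-seq-in p N x x<N = trans (entry-suffix p N N x x<N) (cong p (m∸[m∸n]≡n (<⇒≤ x<N)))

entry-seq-out : ∀ p N x → N ≤ x → entry (seqCode p N) x ≡ 0
entry-seq-out p N x N≤x = trans (cong π₁ (drop-suffix p N N x N≤x)) (π₁-β 0 0)

entry-seq≢0 : ∀ p N x → entry (seqCode p N) x ≢ 0 → x < N × p x ≢ 0
entry-seq≢0 p N x entry≢0 with x <? N
... | yes x<N = x<N , λ px≡0 → entry≢0 (trans (entry-seq-in p N x x<N) px≡0)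
... | no  x≮N = ⊥-elim (entry≢0 (entry-seq-out p N x (≮⇒≥ x≮N)))

seqCode-mono : ∀ {p q} N → (∀ i → p i ≤ q i) → seqCode p N ≤ seqCode q N
seqCode-mono {p} {q} N p≤q = go N
  where
    go : ∀ k → suffix p N k ≤ suffix q N k
    go zero    = z≤n
    go (suc k) = pair-mono (p≤q (N ∸ suc k)) (go k)

χ-true : ∀ P x → P x ≡ true → χ P x ≡ 1
χ-true P x _ with P x
... | true = refl

χ≢0 : ∀ P x → χ P x ≢ 0 → P x ≡ true
χ≢0 P x χ≢0 with P x
... | true  = refl
... | false = ⊥-elim (χ≢0 refl)

χ≤1 : ∀ P x → χ P x ≤ 1
χ≤1 P x with P x
... | true  = s≤s z≤n
... | false = z≤n

isZero-χ : ∀ P x → isZero (χ P x) ≡ χ (not ∘ P) x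
isZero-χ P x with P x
... | true  = refl
... | false = refl

below : (ℕ → Bool) → ℕ → List ℕ
below P zero    = []
below P (suc n) = if P n then n ∷ below P n else below P n

below-sound : ∀ P n → All (λ x → x < n × P x ≡ true) (below P n)
below-sound P zero = []
below-sound P (suc n) with P n in Pn
... | true  = (≤-refl , Pn) ∷ All.map (map₁ m<n⇒m<1+n) (below-sound P n)
... | false = All.map (map₁ m<n⇒m<1+n) (below-sound P n)

below-unique : ∀ P n → Unique (below P n)
below-unique P zero = []
below-unique P (suc n) with P n
... | true  = All.map (λ (x<n , _) n≡x → <-irrefl (sym n≡x) x<n) (below-sound P n) ∷ below-unique P n
... | false = below-unique P n

below-split : ∀ P n → length (below P n) + length (below (not ∘ P) n) ≡ n
below-split P zero = refl
below-split P (suc n) with P n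
... | true  = cong suc (below-split P n)
... | false = trans (+-suc _ _) (cong suc (below-split P n))

immunity-count : ∀ {A : ℕ → Set} P n {d k} → (W⊆ d A → CardW≤ d k) → W⊆ d A →
  (∀ x → x < n → P x ≡ true → x ∈W d) → length (below P n) ≤ k
immunity-count P n bound W⊆A complete =
  bound W⊆A (below P n) (below-unique P n) (All.map (λ (x<n , Px) → complete _ x<n Px) (below-sound P n))

-- The diagonal c.e. sets

-- On input ⟨ x , n ⟩: run c on e, apply the selector s to the result and
-- output 0 iff the x-th entry of the selected sequence is nonzero.
probe : Code → Code → ℕ → Code
probe s c e = comp isZeroP (comp fst (comp dropP (pairC (comp s (comp c (const e))) fst)))

probe-ev : ∀ {O s c e v w} → Eval O c e v → Eval O s v w → ∀ x n →
  Eval O (probe s c e) ⟨ x , n ⟩ (isZero (entry w x))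
probe-ev {e = e} {w = w} run select x n =
  ev-comp (ev-comp (ev-comp (pair-ev w x (ev-comp (ev-comp (const-ev e) run) select) (ev-fst {a = x} {b = n}))
                            (drop-ev w x))
                   (π₁-ev (drop w x)))
          (isZero-ev (entry w x))

-- The template of mu (probe s c (encode c)).  It is kept opaque: unfolding
-- it makes the typechecker start evaluating the enormous codes of its parts.
opaque
  diagTemplate : Code → Template
  diagTemplate s = muT (compT (lit isZeroP) (compT (lit fst) (compT (lit dropP)
                     (pairT (compT (lit s) (compT self selfCode)) (lit fst)))))

  fill-diagTemplate : ∀ s c → fill (diagTemplate s) c ≡ mu (probe s c (encode c))
  fill-diagTemplate s c = refl

-- diag s e : a computable index of the set of positions at which the
-- s-component of Φ_e(e) is nonzero (halting of mu (probe …) on x).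
diag : Code → ℕ → ℕ
diag s = index (diagTemplate s)

diag-code : ∀ s c → encode (mu (probe s c (encode c))) ≡ diag s (encode c)
diag-code s c = trans (cong encode {mu (probe s c (encode c))} {fill (diagTemplate s) c} (sym (fill-diagTemplate s c)))
                      (sym (index-fill (diagTemplate s) c))

mu-zero : ∀ {O F x n} → Eval O (mu F) x n → Eval O F ⟨ x , n ⟩ 0
mu-zero (ev-mu F≡0 _) = F≡0

-- W_{diag s e} is exactly the set of nonzero positions of w, the s-component
-- of v = Φ_e(e): soundness uses that programs are determined by their codes.
diag-sound : ∀ {s c v w x} → Eval ∅ c (encode c) v → Eval ∅ s v w →
  x ∈W diag s (encode c) → entry w x ≢ 0
diag-sound {s} {c} {x = x} run select (y , c' , c'-code , halts) =
  isZero≡0⇒≢0 (eval-deterministic (probe-ev run select x y) (mu-zero halts-diag) refl)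
  where
    c'≡diag : c' ≡ mu (probe s c (encode c))
    c'≡diag = encode-injective {c'} {mu (probe s c (encode c))} (trans c'-code (sym (diag-code s c)))

    halts-diag : Eval ∅ (mu (probe s c (encode c))) x y
    halts-diag = subst (λ d → Eval ∅ d x y) c'≡diag halts

diag-complete : ∀ {s c v w x} → Eval ∅ c (encode c) v → Eval ∅ s v w →
  entry w x ≢ 0 → x ∈W diag s (encode c)
diag-complete {s} {c} {x = x} run select entry≢0 =
  0 , mu (probe s c (encode c)) , diag-code s c ,
  ev-mu (subst (Eval ∅ (probe s c (encode c)) ⟨ x , 0 ⟩) (≢0⇒isZero≡0 entry≢0) (probe-ev run select x 0))
        (λ _ ())

diag-seq-sound : ∀ {s c v} P N → Eval ∅ c (encode c) v → Eval ∅ s v (seqCode (χ P) N) →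
  W⊆ (diag s (encode c)) (λ x → P x ≡ true)
diag-seq-sound P N run select x x∈W =
  χ≢0 P x (proj₂ (entry-seq≢0 (χ P) N x (diag-sound run select x∈W)))

diag-seq-complete : ∀ {s c v} P N → Eval ∅ c (encode c) v → Eval ∅ s v (seqCode (χ P) N) →
  ∀ x → x < N → P x ≡ true → x ∈W diag s (encode c)
diag-seq-complete P N run select x x<N Px = diag-complete run select λ entry≡0 →
  1+n≢0 (trans (sym (trans (entry-seq-in (χ P) N x x<N) (χ-true P x Px))) entry≡0)

-- The construction, for X and programs H₁, H₀ computing h₁, h₀

module Construction (X : ℕ → Bool) {h₁ h₀ : ℕ → ℕ} (H₁ H₀ : Code)
                    (H₁-ev : ∀ n → Eval ∅ H₁ n (h₁ n)) (H₀-ev : ∀ n → Eval ∅ H₀ n (h₀ n)) where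

  size : ℕ → ℕ
  size e = suc (h₁ (diag fst e) + h₀ (diag snd e))

  sizeP : Code
  sizeP = comp succ (comp plusP (pairC (comp (strip H₁) (indexP (diagTemplate fst)))
                                       (comp (strip H₀) (indexP (diagTemplate snd)))))

  size-ev : ∀ {O} e → Eval O sizeP e (size e)
  size-ev e = ev-comp (ev-comp (pair-ev (h₁ (diag fst e)) (h₀ (diag snd e))
                                        (ev-comp (index-ev (diagTemplate fst) e) (strip-ev (H₁-ev _)))
                                        (ev-comp (index-ev (diagTemplate snd) e) (strip-ev (H₀-ev _))))
                               (plus-ev (h₁ (diag fst e)) (h₀ (diag snd e))))
                      ev-succ

  seqPair : (ℕ → ℕ) → (ℕ → ℕ) → ℕ → ℕ
  seqPair p₁ p₀ e = ⟨ seqCode p₁ (size e) , seqCode p₀ (size e) ⟩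

  seqPairP : Code → Code → Code
  seqPairP q₁ q₀ = comp (pairC (seqP q₁) (seqP q₀)) sizeP

  seqPair-ev : ∀ {O q₁ q₀ p₁ p₀} → (∀ i → Eval O q₁ i (p₁ i)) → (∀ i → Eval O q₀ i (p₀ i)) →
    ∀ e → Eval O (seqPairP q₁ q₀) e (seqPair p₁ p₀ e)
  seqPair-ev {p₁ = p₁} {p₀} q₁-ev q₀-ev e = ev-comp (size-ev e)
    (pair-ev (seqCode p₁ (size e)) (seqCode p₀ (size e)) (seq-ev q₁-ev (size e)) (seq-ev q₀-ev (size e)))

  f : ℕ → ℕ
  f = seqPair (χ X) (χ (not ∘ X))

  f-computable : Computes X f
  f-computable = seqPairP orc (comp isZeroP orc) , seqPair-ev (λ _ → ev-orc) complement-ev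
    where
      complement-ev : ∀ i → Eval (χ X) (comp isZeroP orc) i (χ (not ∘ X) i)
      complement-ev i = subst (Eval (χ X) (comp isZeroP orc) i) (isZero-χ X i) (ev-comp ev-orc (isZero-ev _))

  -- Entries of characteristic sequences are at most 1.
  f-bounded : ComputablyBounded f
  f-bounded = seqPair one one , (seqPairP (const 1) (const 1) , seqPair-ev (λ _ → const-ev 1) (λ _ → const-ev 1)) ,
              λ e → pair-mono (seqCode-mono (size e) (χ≤1 X)) (seqCode-mono (size e) (χ≤1 (not ∘ X)))
    where
      one : ℕ → ℕ
      one _ = 1

  -- If Φ_e(e) = f(e), the diagonal sets are X ∩ [0,N) and X̄ ∩ [0,N), and
  -- effective immunity would squeeze N elements below N − 1.
  f-dnc : (∀ e → W⊆ e (λ n → n ∈S X) → CardW≤ e (h₁ e)) →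
          (∀ e → W⊆ e (λ n → n ∉S X) → CardW≤ e (h₀ e)) → DNC f
  f-dnc immune₁ immune₀ .(encode c) (c , refl , run) = <-irrefl refl N<N
    where
      N : ℕ
      N = size (encode c)

      first : Eval ∅ fst (f (encode c)) (seqCode (χ X) N)
      first = ev-fst {a = seqCode (χ X) N} {b = seqCode (χ (not ∘ X)) N}

      second : Eval ∅ snd (f (encode c)) (seqCode (χ (not ∘ X)) N)
      second = ev-snd {a = seqCode (χ X) N} {b = seqCode (χ (not ∘ X)) N}

      count₁ : length (below X N) ≤ h₁ (diag fst (encode c))
      count₁ = immunity-count X N (immune₁ _) (diag-seq-sound X N run first) (diag-seq-complete X N run first)

      count₀ : length (below (not ∘ X) N) ≤ h₀ (diag snd (encode c))
      count₀ = immunity-count (not ∘ X) N (immune₀ _)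
        (λ x x∈W → not-injective (diag-seq-sound (not ∘ X) N run second x x∈W))
        (diag-seq-complete (not ∘ X) N run second)

      N<N : N < N
      N<N = begin-strict
        N                                                  ≡⟨ sym (below-split X N) ⟩
        length (below X N) + length (below (not ∘ X) N)    ≤⟨ +-mono-≤ count₁ count₀ ⟩
        h₁ (diag fst (encode c)) + h₀ (diag snd (encode c)) <⟨ n<1+n _ ⟩
        N                                                  ∎
        where open ≤-Reasoning

mainTheorem10 : (X : ℕ → Bool) → EffectivelyBiImmune X →
    Σ (ℕ → ℕ) λ f → Computes X f × DNC f × ComputablyBounded f
mainTheorem10 X ((_ , h₁ , (H₁ , H₁-ev) , immune₁) , (_ , h₀ , (H₀ , H₀-ev) , immune₀)) =
  f , f-computable , f-dnc immune₁ immune₀ , f-bounded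
  where open Construction X H₁ H₀ H₁-ev H₀-ev
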